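{- If $u$ is an identity term and $u\rightsquigarrow u'$ (general reduction), then $u'$ is an identity term.
   Context: Raw syntax of $\mathrm{Catt}_{\mathrm{su}}$. Fix an infinite set $V$ of variables containing distinct $d_i,d_i'$ ($i\in\mathbb N$). Contexts $\Gamma::=\emptyset\mid\Gamma,x:A$; types $A::=\star\mid s\to_A t$; terms $t::=x\mid\mathsf{coh}(\Gamma:A)[\sigma]$; substitutions $\sigma::=\langle\rangle\mid\langle\sigma,x\mapsto t\rangle$. $\equiv$ is syntactic equality up to $\alpha$-equivalence. Substitution application: $\star[\sigma]=\star$, $(s\to_A t)[\sigma]=s[\sigma]\to_{A[\sigma]}t[\sigma]$, $x[\sigma]$ the entry for $x$, $\mathsf{coh}(\Gamma:A)[\tau][\sigma]=\mathsf{coh}(\Gamma:A)[\tau\circ\sigma]$, $\langle\rangle\circ\sigma=\langle\rangle$, $\langle\tau,x\mapsto t\rangle\circ\sigma=\langle\tau\circ\sigma,x\mapsto t[\sigma]\rangle$. $\dim\star=-1$, $\dim(s\to_A t)=\dim A+1$. Pasting contexts are derived linearly by: $(x:\star)\vdash_p x:\star$; $\Gamma\vdash_p x:A\Rightarrow\Gamma,y:A,f:x\to_A y\vdash_p f:x\to_A y$ (introduction); $\Gamma\vdash_p f:x\to_A y\Rightarrow\Gamma\vdash_p y:A$ (descent); ending at a variable of type $\star$. Locally maximal variables: introduced by an introduction step immediately followed by a descent step. Discs: $D^0=(d_0:\star)$, $S^{ -1}=\star$, $D^{k+1}=D^k,(d_k':S^{k-1}),(d_{k+1}:S^k)$, $S^k=d_k\to_{S^{k-1}}d_k'$;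 $\mathsf{i}_k:=\mathsf{coh}(D^k:d_k\to_{S^{k-1}}d_k)[\mathrm{id}_{D^k}]$; a term is an identity if it is syntactically of the form $\mathsf{i}_k[\tau]$ for some $k\in\mathbb N$ and substitution $\tau$. $\{\star,t\}=\langle t\rangle$, $\{u\to_A v,t\}=\langle\{A,u\},v,t\rangle$. For locally maximal $\alpha:s\to_A t$ of $\Delta$: $\Delta/\!\!/\alpha$ deletes $t,\alpha$; $\pi_\alpha$ sends $\alpha\mapsto\mathsf{i}_{\dim A+1}[\{A,s\}]$, $t\mapsto s$, others fixed; $\sigma/\!\!/\alpha$ removes the entries for $t,\alpha$. General reduction $\rightsquigarrow$ (simultaneous induction): $\star$ and variables do not reduce; $u\to_T v$ reduces to $u'\to_T v$, $u\to_T v'$ or $u\to_{T'}v$ whenever $u\rightsquigarrow u'$, $v\rightsquigarrow v'$ or $T\rightsquigarrow T'$; a substitution reduces by reducing any one entry; $t\equiv\mathsf{coh}(\Gamma:T)[\sigma]$ reduces via (A) $\sigma\rightsquigarrow\sigma'$ to $\mathsf{coh}(\Gamma:T)[\sigma']$; (B) if $t$ is not an identity and $x$ is a locally maximal variable of $\Gamma$ with $x[\sigma]$ an identity, to $\mathsf{coh}(\Gamma/\!\!/x:T[\pi_x])[\sigma/\!\!/x]$; (C) $T\rightsquigarrow T'$ to $\mathsf{coh}(\Gamma:T')[\sigma]$; (D) $\mathsf{coh}(D^{n+1}:S^n)[\dots,t']\rightsquigarrow t'$; (E) if $t$ is not an identity and $T\equiv u\to_{T_0}u$, to $\mathsf{i}_{\dim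 T_0+1}[\{T_0,u\}\circ\sigma]$. -}

module Defs where

open import Data.Nat using (ℕ; zero; suc; _∸_; _*_; _+_; _<ᵇ_; _≡ᵇ_)
open import Data.Bool using (Bool; true; false; if_then_else_; _∧_; not)
open import Data.List using (List; []; _∷_; _++_; length; map; upTo)
open import Data.Product using (Σ; _×_; _,_)
open import Data.Sum using (_⊎_)
open import Data.Empty using (⊥)
open import Relation.Binary.PropositionalEquality using (_≡_)
open import Relation.Nullary using (¬_)

-- Variables bound by the context Γ of a coherence coh(Γ : A)[σ] are
-- represented canonically by de Bruijn LEVELS (variable  var i  is the
-- i-th variable of Γ, counting from 0), so α-equivalence is plain
-- syntactic equality _≡_.  Free variables (outside all coherences) are
-- names drawn from ℕ (the infinite set V).
-- A context  Γ , x : A  is the list  Γ ++ (A ∷ []) ; a substitution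
-- ⟨σ , x ↦ t⟩ is  σ ++ (t ∷ []) : entry i is the image of level i.

mutual
  data Ty : Set where
    ⋆   : Ty
    arr : Tm → Ty → Tm → Ty          -- arr s A t  =  s →_A t

  data Tm : Set where
    var : ℕ → Tm
    coh : List Ty → Ty → List Tm → Tm

Ctx : Set
Ctx = List Ty

Sub : Set
Sub = List Tm

-- x[σ] : the entry of σ for (level) x; if σ has no such entry the
-- variable is left unchanged (this case never arises for well-scoped terms)
lookupSub : Sub → ℕ → Tm
lookupSub []      n       = var n
lookupSub (t ∷ σ) zero    = t
lookupSub (t ∷ σ) (suc n) = lookupSub σ n

mutual
  _[_]ty : Ty → Sub → Ty
  ⋆ [ σ ]ty           = ⋆
  (arr s A t) [ σ ]ty = arr (s [ σ ]tm) (A [ σ ]ty) (t [ σ ]tm)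

  _[_]tm : Tm → Sub → Tm
  (var x) [ σ ]tm     = lookupSub σ x
  (coh Γ A τ) [ σ ]tm = coh Γ A (τ ∘ σ)

  _∘_ : Sub → Sub → Sub
  []      ∘ σ = []
  (t ∷ τ) ∘ σ = (t [ σ ]tm) ∷ (τ ∘ σ)

-- dim A + 1  (so that dim ⋆ = -1 corresponds to 0)
dim+1 : Ty → ℕ
dim+1 ⋆           = 0
dim+1 (arr _ A _) = suc (dim+1 A)

-- Discs and identities.  In D^k the variable d_i has level 2i and d_i'
-- has level 2i+1.

dv : ℕ → Tm
dv i = var (2 * i)

dv' : ℕ → Tm
dv' i = var (suc (2 * i))

-- Sph k = S^{k-1}   (Sph 0 = S^{-1} = ⋆)
Sph : ℕ → Ty
Sph zero    = ⋆
Sph (suc k) = arr (dv k) (Sph k) (dv' k)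

Disc : ℕ → Ctx
Disc zero    = ⋆ ∷ []
Disc (suc k) = Disc k ++ (Sph k ∷ Sph (suc k) ∷ [])

idSub : Ctx → Sub
idSub Γ = map var (upTo (length Γ))

iTm : ℕ → Tm
iTm k = coh (Disc k) (arr (dv k) (Sph k) (dv k)) (idSub (Disc k))

IsIdentity : Tm → Set
IsIdentity u = Σ ℕ λ k → Σ Sub λ τ → u ≡ (iTm k) [ τ ]tm

brace : Ty → Tm → Sub
brace ⋆           t = t ∷ []
brace (arr u A v) t = brace A u ++ (v ∷ t ∷ [])

data _⊢p_∶_ : Ctx → ℕ → Ty → Set where
  ps-base  : (⋆ ∷ []) ⊢p 0 ∶ ⋆
  ps-intro : ∀ {Γ x A} → Γ ⊢p x ∶ A →
             (Γ ++ (A ∷ arr (var x) A (var (length Γ)) ∷ []))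
               ⊢p suc (length Γ) ∶ arr (var x) A (var (length Γ))
  ps-desc  : ∀ {Γ f x y A} → Γ ⊢p f ∶ arr (var x) A (var y) → Γ ⊢p y ∶ A

-- the variables made locally maximal along a derivation: those introduced
-- by an introduction step immediately followed by a descent step
LocMaxIn : ∀ {Γ x A} → Γ ⊢p x ∶ A → ℕ → Set
LocMaxIn ps-base z                        = ⊥
LocMaxIn (ps-intro d) z                   = LocMaxIn d z
LocMaxIn (ps-desc (ps-intro {Γ} d)) z     = LocMaxIn d z ⊎ z ≡ suc (length Γ)
LocMaxIn (ps-desc (ps-desc d)) z          = LocMaxIn (ps-desc d) z

LocMax : Ctx → ℕ → Set
LocMax Γ z = Σ ℕ λ y → Σ (Γ ⊢p y ∶ ⋆) λ d → LocMaxIn d z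

-- Pruning  Δ//α , π_α , σ//α  for  α : s →_A t  (α, t given as levels).
-- Removing the levels of t and α shifts the later levels down; the
-- renaming ρ realises "all other variables are fixed" on canonical names.

lookupCtx : Ctx → ℕ → Ty
lookupCtx []      n       = ⋆
lookupCtx (A ∷ Γ) zero    = A
lookupCtx (A ∷ Γ) (suc n) = lookupCtx Γ n

tgtLevel : Ctx → ℕ → ℕ
tgtLevel Γ a with lookupCtx Γ a
... | arr _ _ (var t) = t
... | _               = a

kept : ℕ → ℕ → ℕ → Bool
kept t a i = not (i ≡ᵇ t) ∧ not (i ≡ᵇ a)

filterIx : {X : Set} → (ℕ → Bool) → ℕ → List X → List X
filterIx p n []       = []
filterIx p n (x ∷ xs) = if p n then x ∷ filterIx p (suc n) xs
                               else filterIx p (suc n) xs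

newLevel : ℕ → ℕ → ℕ → ℕ
newLevel t a i = (i ∸ (if t <ᵇ i then 1 else 0)) ∸ (if a <ᵇ i then 1 else 0)

ren : Ctx → ℕ → Sub
ren Γ a = map (λ i → var (newLevel (tgtLevel Γ a) a i)) (upTo (length Γ))

_//_ : Ctx → ℕ → Ctx
Γ // a = map (λ A → A [ ren Γ a ]ty) (filterIx (kept (tgtLevel Γ a) a) 0 Γ)

_//s_[_] : Sub → Ctx → ℕ → Sub
σ //s Γ [ a ] = filterIx (kept (tgtLevel Γ a) a) 0 σ

πEntry : Ctx → ℕ → ℕ → Tm
πEntry Γ a i with lookupCtx Γ a
... | arr s A _ =
  if i ≡ᵇ a then ((iTm (dim+1 A)) [ brace A s ]tm) [ ren Γ a ]tm
  else if i ≡ᵇ tgtLevel Γ a then s [ ren Γ a ]tm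
  else var (newLevel (tgtLevel Γ a) a i)
... | ⋆ = var (newLevel (tgtLevel Γ a) a i)

π : Ctx → ℕ → Sub
π Γ a = map (πEntry Γ a) (upTo (length Γ))

mutual
  data _⇝ty_ : Ty → Ty → Set where
    arr-l : ∀ {u u' T v} → u ⇝tm u' → arr u T v ⇝ty arr u' T v
    arr-r : ∀ {u T v v'} → v ⇝tm v' → arr u T v ⇝ty arr u T v'
    arr-T : ∀ {u T T' v} → T ⇝ty T' → arr u T v ⇝ty arr u T' v

  data _⇝sub_ : Sub → Sub → Set where
    here  : ∀ {t t' σ} → t ⇝tm t' → (t ∷ σ) ⇝sub (t' ∷ σ)
    there : ∀ {t σ σ'} → σ ⇝sub σ' → (t ∷ σ) ⇝sub (t ∷ σ')

  data _⇝tm_ : Tm → Tm → Set where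
    ruleA : ∀ {Γ T σ σ'} → σ ⇝sub σ' → coh Γ T σ ⇝tm coh Γ T σ'
    ruleB : ∀ {Γ T σ} (x : ℕ) → ¬ IsIdentity (coh Γ T σ) → LocMax Γ x →
            IsIdentity (lookupSub σ x) →
            coh Γ T σ ⇝tm coh (Γ // x) (T [ π Γ x ]ty) (σ //s Γ [ x ])
    ruleC : ∀ {Γ T T' σ} → T ⇝ty T' → coh Γ T σ ⇝tm coh Γ T' σ
    ruleD : ∀ (n : ℕ) (σ : Sub) (t' : Tm) →
            coh (Disc (suc n)) (Sph (suc n)) (σ ++ (t' ∷ [])) ⇝tm t'
    ruleE : ∀ {Γ u T₀ σ} → ¬ IsIdentity (coh Γ (arr u T₀ u) σ) →
            coh Γ (arr u T₀ u) σ ⇝tm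
              ((iTm (dim+1 T₀)) [ brace T₀ u ∘ σ ]tm)

{-# OPTIONS --safe #-}

-- An identity coh(D^k : d_k → d_k)[id ∘ τ] stays an identity when its
-- substitution reduces, because id ∘ σ ≡ σ for every σ of the length of D^k.
-- No other rule applies: rules B and E exclude identities, the type of an
-- identity is built from variables and so cannot reduce, and rule D needs the
-- type S^n, whose source d_n and target d_n' are distinct variables.

module Submission where

open import Defs
open import Data.Nat using (ℕ; suc)
open import Data.Nat.Properties using (even≢odd)
open import Data.List using ([]; _∷_; length; map; applyUpTo; upTo)
open import Data.List.Properties using (length-map; length-applyUpTo; map-applyUpTo)
open import Data.Product using (_,_)
open import Data.Empty using (⊥-elim)
open import Function using (id)
open import Relation.Binary.PropositionalEquality
open import Relation.Nullary using (¬_)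

open ≡-Reasoning

idTy : ℕ → Ty
idTy k = arr (dv k) (Sph k) (dv k)

length-∘ : (τ σ : Sub) → length (τ ∘ σ) ≡ length τ
length-∘ []      σ = refl
length-∘ (t ∷ τ) σ = cong suc (length-∘ τ σ)

length-idSub : (Γ : Ctx) → length (idSub Γ) ≡ length Γ
length-idSub Γ = trans (length-map var (upTo (length Γ))) (length-applyUpTo id (length Γ))

applyUpTo-lookupSub : (σ : Sub) → applyUpTo (lookupSub σ) (length σ) ≡ σ
applyUpTo-lookupSub []      = refl
applyUpTo-lookupSub (t ∷ σ) = cong (t ∷_) (applyUpTo-lookupSub σ)

map-var-∘ : ∀ xs (σ : Sub) → map var xs ∘ σ ≡ map (lookupSub σ) xs
map-var-∘ []       σ = refl
map-var-∘ (x ∷ xs) σ = cong (lookupSub σ x ∷_) (map-var-∘ xs σ)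

idSub-∘ : (Γ : Ctx) (σ : Sub) → length σ ≡ length Γ → idSub Γ ∘ σ ≡ σ
idSub-∘ Γ σ σ∶Γ = begin
  map var (upTo (length Γ)) ∘ σ        ≡⟨ map-var-∘ (upTo (length Γ)) σ ⟩
  map (lookupSub σ) (upTo (length Γ))  ≡⟨ map-applyUpTo id (lookupSub σ) (length Γ) ⟩
  applyUpTo (lookupSub σ) (length Γ)   ≡⟨ cong (applyUpTo (lookupSub σ)) (sym σ∶Γ) ⟩
  applyUpTo (lookupSub σ) (length σ)   ≡⟨ applyUpTo-lookupSub σ ⟩
  σ                                    ∎

⇝sub-length : ∀ {σ σ'} → σ ⇝sub σ' → length σ' ≡ length σ
⇝sub-length (here _)  = refl
⇝sub-length (there r) = cong suc (⇝sub-length r)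

isIdentity-coh : ∀ k (σ : Sub) → length σ ≡ length (Disc k) → IsIdentity (coh (Disc k) (idTy k) σ)
isIdentity-coh k σ σ∶Dk = k , σ , cong (coh (Disc k) (idTy k)) (sym (idSub-∘ (Disc k) σ σ∶Dk))

isIdentity-⇝sub : ∀ {Γ T σ σ'} → IsIdentity (coh Γ T σ) → σ ⇝sub σ' → IsIdentity (coh Γ T σ')
isIdentity-⇝sub {σ' = σ'} (k , τ , refl) r = isIdentity-coh k σ' (begin
  length σ'                      ≡⟨ ⇝sub-length r ⟩
  length (idSub (Disc k) ∘ τ)    ≡⟨ length-∘ (idSub (Disc k)) τ ⟩
  length (idSub (Disc k))        ≡⟨ length-idSub (Disc k) ⟩
  length (Disc k)                ∎)

Sph-normal : ∀ k {T} → ¬ (Sph k ⇝ty T)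
Sph-normal (suc k) (arr-T r) = Sph-normal k r

isIdentity-type-normal : ∀ {Γ T σ T'} → IsIdentity (coh Γ T σ) → ¬ (T ⇝ty T')
isIdentity-type-normal (k , τ , refl) (arr-T r) = Sph-normal k r

var-injective : ∀ {m n} → var m ≡ var n → m ≡ n
var-injective refl = refl

arr-endo : ∀ {u A v s B} → arr u A v ≡ arr s B s → u ≡ v
arr-endo refl = refl

Sph-not-endo : ∀ n {s B} → Sph (suc n) ≢ arr s B s
Sph-not-endo n eq = even≢odd n n (var-injective (arr-endo eq))

sphere-coh-not-identity : ∀ n (σ : Sub) → ¬ IsIdentity (coh (Disc (suc n)) (Sph (suc n)) σ)
sphere-coh-not-identity n σ (k , τ , eq) = Sph-not-endo n (cong cohType eq)
  where
  cohType : Tm → Ty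
  cohType (var _)     = ⋆
  cohType (coh _ A _) = A

mainTheorem17 : (u u' : Tm) → IsIdentity u → u ⇝tm u' → IsIdentity u'
mainTheorem17 u u' isId (ruleA r)           = isIdentity-⇝sub isId r
mainTheorem17 u u' isId (ruleB _ notId _ _) = ⊥-elim (notId isId)
mainTheorem17 u u' isId (ruleC r)           = ⊥-elim (isIdentity-type-normal isId r)
mainTheorem17 u u' isId (ruleD n _ _)       = ⊥-elim (sphere-coh-not-identity n _ isId)
mainTheorem17 u u' isId (ruleE notId)       = ⊥-elim (notId isId)
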